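{- Let $m,n\ge 2$ with $\max\{m,n\}\ge3$ (so that $K_{m,n}$ contains a copy of $K_{2,3}$). The matroid ${\mathcal M}_{f_{1,0}}(K_{m,n})$ is the unique maximal $K_{2,3}$-matroid on $K_{m,n}$ and ${\rm val}_{K_{2,3}}$ is its rank function.
   Context: $f_{1,0}(F)=|V(F)|$ for $F\subseteq E(K_{m,n})$, $V(F)$ the set of vertices incident to $F$; ${\mathcal M}_{f_{1,0}}(K_{m,n})$ is the matroid on $E(K_{m,n})$ whose independent sets are those $F$ with $|I|\le |V(I)|$ for every nonempty $I\subseteq F$. A $K_{2,3}$-matroid on $K_{m,n}$ is a matroid on $E(K_{m,n})$ in which the edge set of every subgraph isomorphic to $K_{2,3}$ is a circuit; maximality is in the weak order (${\mathcal M}_1\preceq{\mathcal M}_2$ if every independent set of ${\mathcal M}_1$ is independent in ${\mathcal M}_2$). With ${\mathcal X}$ the family of edge sets of copies of $K_{2,3}$ in $K_{m,n}$: a proper ${\mathcal X}$-sequence is $(X_1,\dots,X_k)$ in ${\mathcal X}$ with $X_i\not\subseteq\bigcup_{j<i}X_j$ for $i\ge2$; ${\rm val}(F,{\mathcal S})=|F\cup\bigcup_iX_i|-k$; ${\rm val}_{K_{2,3}}(F)=\min_{\mathcal S}{\rm val}(F,{\mathcal S})$. -}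

module Defs where

open import Data.Nat using (ℕ; zero; suc; _+_; _∸_; _≤_; _<_)
open import Data.Bool using (Bool; true; false; _∧_; _∨_; not)
open import Data.Fin using (Fin; zero; suc)
open import Data.Product using (Σ; ∃; _×_; _,_)
open import Data.Sum using (_⊎_)
open import Data.List using (List; []; _∷_; length)
open import Data.List.Relation.Unary.All using (All)
open import Data.Unit using (⊤)
open import Relation.Nullary using (¬_)
open import Relation.Binary.PropositionalEquality using (_≡_)
open import Relation.Nullary.Decidable using (⌊_⌋)
import Data.Fin as F

boolToℕ : Bool → ℕ
boolToℕ true  = 1
boolToℕ false = 0

count : (n : ℕ) → (Fin n → Bool) → ℕ
count zero    p = 0
count (suc n) p = boolToℕ (p zero) + count n (λ i → p (suc i))

anyFin : (n : ℕ) → (Fin n → Bool) → Bool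
anyFin zero    p = false
anyFin (suc n) p = p zero ∨ anyFin n (λ i → p (suc i))

sumFin : (n : ℕ) → (Fin n → ℕ) → ℕ
sumFin zero    f = 0
sumFin (suc n) f = f zero + sumFin n (λ i → f (suc i))

-- Edge sets of K_{m,n}: vertex classes Fin m and Fin n, edges Fin m × Fin n.
-- A subset of E(K_{m,n}) is a Boolean-valued function.

ESet : ℕ → ℕ → Set
ESet m n = Fin m → Fin n → Bool

module _ {m n : ℕ} where

  _∈E_ : Fin m × Fin n → ESet m n → Set
  (i , j) ∈E F = F i j ≡ true

  _⊆E_ : ESet m n → ESet m n → Set
  F ⊆E G = ∀ i j → F i j ≡ true → G i j ≡ true

  _⊂E_ : ESet m n → ESet m n → Set
  F ⊂E G = F ⊆E G × ∃ λ e → (e ∈E G) × ¬ (e ∈E F)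

  _∪E_ : ESet m n → ESet m n → ESet m n
  (F ∪E G) i j = F i j ∨ G i j

  ∅E : ESet m n
  ∅E i j = false

  ⟦_⟧E : Fin m × Fin n → ESet m n
  ⟦ (a , b) ⟧E i j = ⌊ i F.≟ a ⌋ ∧ ⌊ j F.≟ b ⌋

  NonEmpty : ESet m n → Set
  NonEmpty F = ∃ λ e → e ∈E F

  ∣_∣E : ESet m n → ℕ
  ∣ F ∣E = sumFin m (λ i → count n (F i))

  ∣V_∣ : ESet m n → ℕ
  ∣V F ∣ = count m (λ i → anyFin n (F i)) + count n (λ j → anyFin m (λ i → F i j))

  f₁₀ : ESet m n → ℕ
  f₁₀ F = ∣V F ∣

  IndepPred : Set₁
  IndepPred = ESet m n → Set

  record IsMatroid (Ind : IndepPred) : Set where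
    field
      indep-∅       : Ind ∅E
      indep-down    : ∀ {F G} → F ⊆E G → Ind G → Ind F
      indep-augment : ∀ {F G} → Ind F → Ind G → ∣ F ∣E < ∣ G ∣E →
                      ∃ λ e → (e ∈E G) × ¬ (e ∈E F) × Ind (F ∪E ⟦ e ⟧E)

  IsCircuit : IndepPred → ESet m n → Set
  IsCircuit Ind C = ¬ Ind C × (∀ D → D ⊂E C → Ind D)

  _⪯_ : IndepPred → IndepPred → Set
  I₁ ⪯ I₂ = ∀ F → I₁ F → I₂ F

  IsRankFunction : IndepPred → (ESet m n → ℕ) → Set
  IsRankFunction Ind r = ∀ F →
    (∃ λ I → I ⊆E F × Ind I × ∣ I ∣E ≡ r F) ×
    (∀ I → I ⊆E F → Ind I → ∣ I ∣E ≤ r F)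

  Indep-f₁₀ : IndepPred
  Indep-f₁₀ F = ∀ I → I ⊆E F → NonEmpty I → ∣ I ∣E ≤ f₁₀ I

  IsK23 : ESet m n → Set
  IsK23 X = ∃ λ (A : Fin m → Bool) → ∃ λ (B : Fin n → Bool) →
    ((count m A ≡ 2 × count n B ≡ 3) ⊎ (count m A ≡ 3 × count n B ≡ 2)) ×
    (∀ i j → X i j ≡ (A i ∧ B j))

  K23Matroid : IndepPred → Set
  K23Matroid Ind = IsMatroid Ind × (∀ X → IsK23 X → IsCircuit Ind X)

  IsMaximalK23 : IndepPred → Set₁
  IsMaximalK23 Ind = K23Matroid Ind × (∀ J → K23Matroid J → Ind ⪯ J → J ⪯ Ind)

  ⋃E : List (ESet m n) → ESet m n
  ⋃E []       = ∅E
  ⋃E (X ∷ Xs) = X ∪E ⋃E Xs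

  ProperFrom : ESet m n → List (ESet m n) → Set
  ProperFrom U []       = ⊤
  ProperFrom U (X ∷ Xs) = ¬ (X ⊆E U) × ProperFrom (U ∪E X) Xs

  ProperSeq : List (ESet m n) → Set
  ProperSeq []       = ⊤
  ProperSeq (X ∷ Xs) = ProperFrom X Xs

  IsXSeq : List (ESet m n) → Set
  IsXSeq S = All IsK23 S × ProperSeq S

  -- val(F, S) = |F ∪ ⋃ S| - k  (the difference is never truncated for proper sequences)
  val : ESet m n → List (ESet m n) → ℕ
  val F S = ∣ F ∪E ⋃E S ∣E ∸ length S

  IsValK23 : ESet m n → ℕ → Set
  IsValK23 F v = (∃ λ S → IsXSeq S × val F S ≡ v) × (∀ S → IsXSeq S → v ≤ val F S)

{-# OPTIONS --safe #-}
-- M_f₁₀ is the matroid induced by the monotone submodular function f₁₀: augmentation works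
-- because unions of tight subsets (|V(T)| ≤ |T|) of an independent set are again tight.
-- A copy of K_{2,3} has six edges on five vertices while all its proper subgraphs are sparse,
-- so it is a circuit. In any matroid, each member of a proper sequence of circuits makes one
-- further edge redundant, so an independent subset of F ∪ ⋃ Xᵢ has at most |F ∪ ⋃ Xᵢ| − k edges.
-- A complete bipartite graph K_{a,b} with a, b ≥ 2 carries a proper K_{2,3}-sequence of length
-- ab − a − b; hence in every K_{2,3}-matroid an independent set I has |I| ≤ |V(I)|, i.e.
-- M_f₁₀ dominates every K_{2,3}-matroid. Finally, for a basis B of F the edges of F outside B
-- lie in the complete bipartite graph on the vertices of a tight T ⊆ B, and filling that graph
-- with a K_{2,3}-sequence shows that val_{K_{2,3}}(F) = |B|.
module Submission where

open import Defs
open import Algebra.Bundles using (CommutativeMonoid)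
open import Data.Nat using (ℕ; zero; suc; _+_; _*_; _∸_; _≤_; _<_; _⊔_; _≤?_; z≤n; s≤s)
open import Data.Nat.Properties
  using ( *-comm; *-distribʳ-+; *-identityʳ; *-zeroʳ; +-assoc; +-comm; +-identityʳ; +-suc
        ; +-cancelʳ-≤; +-cancelˡ-≤; +-mono-≤; +-monoʳ-≤; +-monoˡ-≤; +-commutativeSemigroup
        ; <-irrefl; <⇒≱; ≰⇒>; ≤-antisym; ≤-pred; ≤-refl; ≤-reflexive; ≤-trans
        ; m+n∸n≡m; m+n≤o⇒m≤o∸n; m≤m+n; m≤n+m; m≤n⇒m≤1+n; n≤1+n; suc-injective
        ; module ≤-Reasoning )
open import Data.Nat.Tactic.RingSolver using (solve-∀)
open import Algebra.Properties.CommutativeSemigroup +-commutativeSemigroup using (interchange; xy∙z≈xz∙y)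
open import Data.Bool using (Bool; true; false; _∧_; _∨_; not)
open import Data.Bool.Properties as Bool using (∨-commutativeMonoid; ¬-not; ∧-zeroʳ; ∨-assoc; ∨-identityʳ)
open import Algebra.Properties.CommutativeSemigroup (CommutativeMonoid.commutativeSemigroup ∨-commutativeMonoid)
  using () renaming (interchange to ∨-interchange)
open import Data.Fin using (Fin; zero; suc; _≟_)
open import Data.Fin.Properties as Fin using (all?; any?; ¬∀⟶∃¬)
open import Data.Product using (∃; ∃₂; _×_; _,_; proj₁; proj₂)
open import Data.Sum using (_⊎_; inj₁; inj₂)
open import Data.List using (List; []; _∷_; length; _++_; cartesianProduct; cartesianProductWith; allFin)
open import Data.List.Properties using (length-++)
open import Data.List.Relation.Unary.All as All using (All; []; _∷_)
open import Data.List.Relation.Unary.All.Properties using (++⁺)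
open import Data.List.Relation.Unary.Any using (here; there)
open import Data.List.Membership.Propositional using (_∈_)
open import Data.List.Membership.Propositional.Properties using (∈-cartesianProduct⁺; ∈-cartesianProductWith⁺; ∈-allFin)
open import Data.Unit using (tt)
open import Data.Empty using (⊥; ⊥-elim)
open import Relation.Nullary using (¬_; Dec; yes; no; _→-dec_)
open import Relation.Nullary.Decidable using (⌊_⌋)
open import Relation.Binary.PropositionalEquality

∧-elimˡ : ∀ {a b} → a ∧ b ≡ true → a ≡ true
∧-elimˡ {true} _ = refl

∧-elimʳ : ∀ {a b} → a ∧ b ≡ true → b ≡ true
∧-elimʳ {true} h = h

∧-intro : ∀ {a b} → a ≡ true → b ≡ true → a ∧ b ≡ true
∧-intro refl refl = refl

∨-introˡ : ∀ {a} b → a ≡ true → a ∨ b ≡ true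
∨-introˡ b refl = refl

∨-introʳ : ∀ a {b} → b ≡ true → a ∨ b ≡ true
∨-introʳ true  _ = refl
∨-introʳ false h = h

∨-elim : ∀ {a b} → a ∨ b ≡ true → a ≡ true ⊎ b ≡ true
∨-elim {true}  _ = inj₁ refl
∨-elim {false} h = inj₂ h

true≢false : ∀ {a} → a ≡ true → a ≡ false → ⊥
true≢false refl ()

true⊎false : ∀ a → a ≡ true ⊎ a ≡ false
true⊎false true  = inj₁ refl
true⊎false false = inj₂ refl

not-true⇒false : ∀ {a} → not a ≡ true → a ≡ false
not-true⇒false {false} _ = refl

_⊆V_ : ∀ {k} → (Fin k → Bool) → (Fin k → Bool) → Set
p ⊆V q = ∀ i → p i ≡ true → q i ≡ true

⊆V-refl : ∀ {k} {p : Fin k → Bool} → p ⊆V p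
⊆V-refl _ h = h

_≡ᵇ_ : ∀ {k} → Fin k → Fin k → Bool
i ≡ᵇ a = ⌊ i ≟ a ⌋

≡ᵇ-refl : ∀ {k} (i : Fin k) → (i ≡ᵇ i) ≡ true
≡ᵇ-refl i with i ≟ i
... | yes _  = refl
... | no i≢i = ⊥-elim (i≢i refl)

≡ᵇ⇒≡ : ∀ {k} {i a : Fin k} → (i ≡ᵇ a) ≡ true → i ≡ a
≡ᵇ⇒≡ {i = i} {a} h with i ≟ a
... | yes p = p

boolToℕ-mono : ∀ {a b} → (a ≡ true → b ≡ true) → boolToℕ a ≤ boolToℕ b
boolToℕ-mono {false} _ = z≤n
boolToℕ-mono {true}  h rewrite h refl = ≤-refl

count-cong : ∀ k {p q : Fin k → Bool} → (∀ i → p i ≡ q i) → count k p ≡ count k q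
count-cong zero    _ = refl
count-cong (suc k) h = cong₂ _+_ (cong boolToℕ (h zero)) (count-cong k (λ i → h (suc i)))

count-mono : ∀ k {p q : Fin k → Bool} → p ⊆V q → count k p ≤ count k q
count-mono zero    _ = z≤n
count-mono (suc k) h = +-mono-≤ (boolToℕ-mono (h zero)) (count-mono k (λ i → h (suc i)))

count-mono-< : ∀ k {p q : Fin k → Bool} → p ⊆V q → ∀ i → q i ≡ true → p i ≡ false →
               count k p < count k q
count-mono-< (suc k) h zero qi pi rewrite qi | pi = s≤s (count-mono k (λ i → h (suc i)))
count-mono-< (suc k) {p} {q} h (suc i) qi pi =
  subst (_≤ count (suc k) q) (+-suc (boolToℕ (p zero)) _)
    (+-mono-≤ (boolToℕ-mono (h zero)) (count-mono-< k (λ j → h (suc j)) i qi pi))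

count-⊆-≡⇒⊇ : ∀ k {p q : Fin k → Bool} → p ⊆V q → count k p ≡ count k q → q ⊆V p
count-⊆-≡⇒⊇ k {p} h e i qi with true⊎false (p i)
... | inj₁ pi = pi
... | inj₂ pi = ⊥-elim (<-irrefl e (count-mono-< k h i qi pi))

count-false : ∀ k {p : Fin k → Bool} → (∀ i → p i ≡ false) → count k p ≡ 0
count-false zero    _ = refl
count-false (suc k) h rewrite h zero = count-false k (λ i → h (suc i))

count-pos : ∀ k (p : Fin k → Bool) → 0 < count k p → ∃ λ i → p i ≡ true
count-pos (suc k) p h with p zero in eq
... | true  = zero , eq
... | false with count-pos k (λ i → p (suc i)) h
...   | i , pi = suc i , pi

count-unique : ∀ k {p : Fin k → Bool} (a : Fin k) → p a ≡ true → (∀ i → p i ≡ true → i ≡ a) →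
               count k p ≡ 1
count-unique (suc k) {p} zero pa h rewrite pa =
  cong suc (count-false k (λ i → ¬-not (λ pi → Fin.0≢1+n (sym (h (suc i) pi)))))
count-unique (suc k) {p} (suc a) pa h with true⊎false (p zero)
... | inj₁ p0 with () ← h zero p0
... | inj₂ p0 rewrite p0 = count-unique k a pa (λ i pi → Fin.suc-injective (h (suc i) pi))

count-≡ᵇ : ∀ k (a : Fin k) → count k (_≡ᵇ a) ≡ 1
count-≡ᵇ k a = count-unique k a (≡ᵇ-refl a) (λ _ → ≡ᵇ⇒≡)

count-∨+count-∧ : ∀ k (p q : Fin k → Bool) →
  count k (λ i → p i ∨ q i) + count k (λ i → p i ∧ q i) ≡ count k p + count k q
count-∨+count-∧ zero    p q = refl
count-∨+count-∧ (suc k) p q = begin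
  (boolToℕ (p zero ∨ q zero) + count k _) + (boolToℕ (p zero ∧ q zero) + count k _)
    ≡⟨ interchange (boolToℕ (p zero ∨ q zero)) _ _ _ ⟩
  (boolToℕ (p zero ∨ q zero) + boolToℕ (p zero ∧ q zero)) + (count k _ + count k _)
    ≡⟨ cong₂ _+_ (bool (p zero) (q zero)) (count-∨+count-∧ k (λ i → p (suc i)) (λ i → q (suc i))) ⟩
  (boolToℕ (p zero) + boolToℕ (q zero)) + (count k _ + count k _)
    ≡⟨ interchange (boolToℕ (p zero)) _ _ _ ⟩
  count (suc k) p + count (suc k) q ∎
  where
  open ≡-Reasoning
  bool : ∀ a b → boolToℕ (a ∨ b) + boolToℕ (a ∧ b) ≡ boolToℕ a + boolToℕ b
  bool true  true  = refl
  bool true  false = refl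
  bool false b     = +-identityʳ _

count-split : ∀ k (p q : Fin k → Bool) →
  count k p ≡ count k (λ i → p i ∧ q i) + count k (λ i → p i ∧ not (q i))
count-split zero    p q = refl
count-split (suc k) p q =
  trans (cong₂ _+_ (bool (p zero) (q zero)) (count-split k (λ i → p (suc i)) (λ i → q (suc i))))
        (interchange (boolToℕ (p zero ∧ q zero)) _ _ _)
  where
  bool : ∀ a b → boolToℕ a ≡ boolToℕ (a ∧ b) + boolToℕ (a ∧ not b)
  bool true  true  = refl
  bool true  false = refl
  bool false b     = refl

count-∧ˡ : ∀ k x (q : Fin k → Bool) → count k (λ j → x ∧ q j) ≡ boolToℕ x * count k q
count-∧ˡ k true  q = sym (+-identityʳ _)
count-∧ˡ k false q = count-false k (λ _ → refl)

anyFin-intro : ∀ k (p : Fin k → Bool) j → p j ≡ true → anyFin k p ≡ true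
anyFin-intro (suc k) p zero    h = ∨-introˡ _ h
anyFin-intro (suc k) p (suc j) h = ∨-introʳ (p zero) (anyFin-intro k (λ i → p (suc i)) j h)

anyFin-elim : ∀ k (p : Fin k → Bool) → anyFin k p ≡ true → ∃ λ j → p j ≡ true
anyFin-elim (suc k) p h with ∨-elim {p zero} h
... | inj₁ p0 = zero , p0
... | inj₂ ps with anyFin-elim k (λ i → p (suc i)) ps
...   | j , pj = suc j , pj

anyFin-mono : ∀ k {p q : Fin k → Bool} → p ⊆V q → anyFin k p ≡ true → anyFin k q ≡ true
anyFin-mono k {p} {q} h a with anyFin-elim k p a
... | j , pj = anyFin-intro k q j (h j pj)

anyFin-cong : ∀ k {p q : Fin k → Bool} → (∀ i → p i ≡ q i) → anyFin k p ≡ anyFin k q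
anyFin-cong zero    _ = refl
anyFin-cong (suc k) h = cong₂ _∨_ (h zero) (anyFin-cong k (λ i → h (suc i)))

anyFin-false : ∀ k → anyFin k (λ _ → false) ≡ false
anyFin-false zero    = refl
anyFin-false (suc k) = anyFin-false k

anyFin-∨ : ∀ k (p q : Fin k → Bool) → anyFin k (λ i → p i ∨ q i) ≡ anyFin k p ∨ anyFin k q
anyFin-∨ zero    p q = refl
anyFin-∨ (suc k) p q =
  trans (cong ((p zero ∨ q zero) ∨_) (anyFin-∨ k (λ i → p (suc i)) (λ i → q (suc i))))
        (∨-interchange (p zero) (q zero) _ _)

sumFin-cong : ∀ k {f g : Fin k → ℕ} → (∀ i → f i ≡ g i) → sumFin k f ≡ sumFin k g
sumFin-cong zero    _ = refl
sumFin-cong (suc k) h = cong₂ _+_ (h zero) (sumFin-cong k (λ i → h (suc i)))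

sumFin-mono : ∀ k {f g : Fin k → ℕ} → (∀ i → f i ≤ g i) → sumFin k f ≤ sumFin k g
sumFin-mono zero    _ = z≤n
sumFin-mono (suc k) h = +-mono-≤ (h zero) (sumFin-mono k (λ i → h (suc i)))

sumFin-mono-< : ∀ k {f g : Fin k → ℕ} → (∀ i → f i ≤ g i) → ∀ i → f i < g i → sumFin k f < sumFin k g
sumFin-mono-< (suc k) h zero    lt = +-mono-≤ lt (sumFin-mono k (λ i → h (suc i)))
sumFin-mono-< (suc k) {f} {g} h (suc i) lt =
  subst (_≤ sumFin (suc k) g) (+-suc (f zero) _)
    (+-mono-≤ (h zero) (sumFin-mono-< k (λ j → h (suc j)) i lt))

sumFin-+ : ∀ k (f g : Fin k → ℕ) → sumFin k (λ i → f i + g i) ≡ sumFin k f + sumFin k g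
sumFin-+ zero    f g = refl
sumFin-+ (suc k) f g =
  trans (cong (f zero + g zero +_) (sumFin-+ k (λ i → f (suc i)) (λ i → g (suc i))))
        (interchange (f zero) (g zero) _ _)

sumFin-zero : ∀ k {f : Fin k → ℕ} → (∀ i → f i ≡ 0) → sumFin k f ≡ 0
sumFin-zero zero    _ = refl
sumFin-zero (suc k) h rewrite h zero = sumFin-zero k (λ i → h (suc i))

sumFin-count : ∀ k (p : Fin k → Bool) c → sumFin k (λ i → boolToℕ (p i) * c) ≡ count k p * c
sumFin-count zero    p c = refl
sumFin-count (suc k) p c =
  trans (cong (boolToℕ (p zero) * c +_) (sumFin-count k (λ i → p (suc i)) c))
        (sym (*-distribʳ-+ c (boolToℕ (p zero)) _))

module _ {m n : ℕ} where

  _≈E_ : ESet m n → ESet m n → Set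
  F ≈E G = ∀ i j → F i j ≡ G i j

  _∩E_ : ESet m n → ESet m n → ESet m n
  (F ∩E G) i j = F i j ∧ G i j

  _∖E_ : ESet m n → ESet m n → ESet m n
  (F ∖E G) i j = F i j ∧ not (G i j)

  K⟨_,_⟩ : (Fin m → Bool) → (Fin n → Bool) → ESet m n
  K⟨ A , B ⟩ i j = A i ∧ B j

  V₁ : ESet m n → Fin m → Bool
  V₁ F i = anyFin n (F i)

  V₂ : ESet m n → Fin n → Bool
  V₂ F j = anyFin m (λ i → F i j)

  K[_] : ESet m n → ESet m n
  K[ F ] = K⟨ V₁ F , V₂ F ⟩

  ⊆-refl : {F : ESet m n} → F ⊆E F
  ⊆-refl i j h = h

  ⊆-trans : {F G H : ESet m n} → F ⊆E G → G ⊆E H → F ⊆E H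
  ⊆-trans F⊆G G⊆H i j h = G⊆H i j (F⊆G i j h)

  ∪-⊆ˡ : {F G : ESet m n} → F ⊆E (F ∪E G)
  ∪-⊆ˡ {G = G} i j = ∨-introˡ (G i j)

  ∪-⊆ʳ : {F G : ESet m n} → G ⊆E (F ∪E G)
  ∪-⊆ʳ {F = F} i j = ∨-introʳ (F i j)

  ∪-lub : {F G H : ESet m n} → F ⊆E H → G ⊆E H → (F ∪E G) ⊆E H
  ∪-lub {F} F⊆H G⊆H i j h with ∨-elim {F i j} h
  ... | inj₁ Fij = F⊆H i j Fij
  ... | inj₂ Gij = G⊆H i j Gij

  ∩-⊆ˡ : {F G : ESet m n} → (F ∩E G) ⊆E F
  ∩-⊆ˡ i j = ∧-elimˡ

  ∩-⊆ʳ : {F G : ESet m n} → (F ∩E G) ⊆E G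
  ∩-⊆ʳ {F} i j = ∧-elimʳ {F i j}

  ∖-⊆ : {F G : ESet m n} → (F ∖E G) ⊆E F
  ∖-⊆ i j = ∧-elimˡ

  K⟨⟩-mono : {A A′ : Fin m → Bool} {B B′ : Fin n → Bool} → A ⊆V A′ → B ⊆V B′ → K⟨ A , B ⟩ ⊆E K⟨ A′ , B′ ⟩
  K⟨⟩-mono {A} A⊆ B⊆ i j h = ∧-intro (A⊆ i (∧-elimˡ h)) (B⊆ j (∧-elimʳ {A i} h))

  ≈⇒⊆ : {F G : ESet m n} → F ≈E G → F ⊆E G
  ≈⇒⊆ F≈G i j h = trans (sym (F≈G i j)) h

  ∣∣-cong : {F G : ESet m n} → F ≈E G → ∣ F ∣E ≡ ∣ G ∣E
  ∣∣-cong h = sumFin-cong m (λ i → count-cong n (h i))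

  ∣∣-mono : {F G : ESet m n} → F ⊆E G → ∣ F ∣E ≤ ∣ G ∣E
  ∣∣-mono h = sumFin-mono m (λ i → count-mono n (h i))

  ∣∣-mono-< : {F G : ESet m n} → F ⊆E G → ∀ i j → G i j ≡ true → F i j ≡ false → ∣ F ∣E < ∣ G ∣E
  ∣∣-mono-< h i j Gij Fij = sumFin-mono-< m (λ i → count-mono n (h i)) i (count-mono-< n (h i) j Gij Fij)

  ∣∣-false : {F : ESet m n} → (∀ i j → F i j ≡ false) → ∣ F ∣E ≡ 0
  ∣∣-false h = sumFin-zero m (λ i → count-false n (h i))

  ∣∪∣+∣∩∣ : (F G : ESet m n) → ∣ F ∪E G ∣E + ∣ F ∩E G ∣E ≡ ∣ F ∣E + ∣ G ∣E
  ∣∪∣+∣∩∣ F G = trans (sym (sumFin-+ m _ _))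
    (trans (sumFin-cong m (λ i → count-∨+count-∧ n (F i) (G i))) (sumFin-+ m _ _))

  ∣∣-split : (F G : ESet m n) → ∣ F ∣E ≡ ∣ F ∩E G ∣E + ∣ F ∖E G ∣E
  ∣∣-split F G = trans (sumFin-cong m (λ i → count-split n (F i) (G i))) (sumFin-+ m _ _)

  ∣K∣ : (A : Fin m → Bool) (B : Fin n → Bool) → ∣ K⟨ A , B ⟩ ∣E ≡ count m A * count n B
  ∣K∣ A B = trans (sumFin-cong m (λ i → count-∧ˡ n (A i) B)) (sumFin-count m A (count n B))

  ⟦⟧-self : (a : Fin m) (b : Fin n) → ⟦ (a , b) ⟧E a b ≡ true
  ⟦⟧-self a b = ∧-intro (≡ᵇ-refl a) (≡ᵇ-refl b)

  ⟦⟧⇒≡ : ∀ {a i : Fin m} {b j : Fin n} → ⟦ (a , b) ⟧E i j ≡ true → i ≡ a × j ≡ b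
  ⟦⟧⇒≡ h = ≡ᵇ⇒≡ (∧-elimˡ h) , ≡ᵇ⇒≡ (∧-elimʳ h)

  ∣⟦⟧∣≡1 : (e : Fin m × Fin n) → ∣ ⟦ e ⟧E ∣E ≡ 1
  ∣⟦⟧∣≡1 (a , b) = trans (∣K∣ (_≡ᵇ a) (_≡ᵇ b))
    (cong₂ _*_ (count-≡ᵇ m a) (count-≡ᵇ n b))

  ∣∪⟦⟧∣ : (F : ESet m n) (a : Fin m) (b : Fin n) → F a b ≡ false → ∣ F ∪E ⟦ (a , b) ⟧E ∣E ≡ suc ∣ F ∣E
  ∣∪⟦⟧∣ F a b Fab = begin
    ∣ F ∪E ⟦ (a , b) ⟧E ∣E                              ≡⟨ sym (+-identityʳ _) ⟩
    ∣ F ∪E ⟦ (a , b) ⟧E ∣E + 0                          ≡⟨ cong (∣ F ∪E ⟦ (a , b) ⟧E ∣E +_) (sym disjoint) ⟩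
    ∣ F ∪E ⟦ (a , b) ⟧E ∣E + ∣ F ∩E ⟦ (a , b) ⟧E ∣E      ≡⟨ ∣∪∣+∣∩∣ F ⟦ (a , b) ⟧E ⟩
    ∣ F ∣E + ∣ ⟦ (a , b) ⟧E ∣E                          ≡⟨ cong (∣ F ∣E +_) (∣⟦⟧∣≡1 (a , b)) ⟩
    ∣ F ∣E + 1                                          ≡⟨ +-comm ∣ F ∣E 1 ⟩
    suc ∣ F ∣E                                          ∎
    where
    open ≡-Reasoning
    disjoint : ∣ F ∩E ⟦ (a , b) ⟧E ∣E ≡ 0
    disjoint = ∣∣-false λ i j → ¬-not λ h → case (⟦⟧⇒≡ (∧-elimʳ {F i j} h)) (∧-elimˡ h)
      where
      case : ∀ {i j} → i ≡ a × j ≡ b → F i j ≡ true → ⊥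
      case (refl , refl) Fab′ = true≢false Fab′ Fab

  ∣∖⟦⟧∣ : (W : ESet m n) (a : Fin m) (b : Fin n) → W a b ≡ true → ∣ W ∣E ≡ suc ∣ W ∖E ⟦ (a , b) ⟧E ∣E
  ∣∖⟦⟧∣ W a b Wab = trans (∣∣-split W ⟦ (a , b) ⟧E)
    (cong (_+ ∣ W ∖E ⟦ (a , b) ⟧E ∣E) (trans (∣∣-cong W∩e≈e) (∣⟦⟧∣≡1 (a , b))))
    where
    W∩e≈e : (W ∩E ⟦ (a , b) ⟧E) ≈E ⟦ (a , b) ⟧E
    W∩e≈e i j with true⊎false (⟦ (a , b) ⟧E i j)
    ... | inj₂ e = trans (cong (W i j ∧_) e) (trans (∧-zeroʳ (W i j)) (sym e))
    ... | inj₁ e with ⟦⟧⇒≡ {a} {i} {b} {j} e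
    ...   | refl , refl rewrite Wab = refl

  ⟦⟧-⊆ : {F : ESet m n} (a : Fin m) (b : Fin n) → F a b ≡ true → ⟦ (a , b) ⟧E ⊆E F
  ⟦⟧-⊆ a b Fab i j h with ⟦⟧⇒≡ {a} {i} {b} {j} h
  ... | refl , refl = Fab

  ⊆∖∪ : {F G : ESet m n} → F ⊆E ((F ∖E G) ∪E G)
  ⊆∖∪ {F} {G} i j Fij with true⊎false (G i j)
  ... | inj₁ Gij = ∨-introʳ _ Gij
  ... | inj₂ Gij = ∨-introˡ (G i j) (∧-intro Fij (cong not Gij))

  ⊆⇒∩≈ : {F G : ESet m n} → G ⊆E F → (F ∩E G) ≈E G
  ⊆⇒∩≈ {F} {G} G⊆F i j with true⊎false (G i j)
  ... | inj₁ Gij rewrite Gij | G⊆F i j Gij = refl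
  ... | inj₂ Gij rewrite Gij = ∧-zeroʳ (F i j)

  restriction-bound : {U W I : ESet m n} → U ⊆E W → I ⊆E W → ∣ I ∣E + ∣ U ∣E ≤ ∣ I ∩E U ∣E + ∣ W ∣E
  restriction-bound {U} {W} {I} U⊆W I⊆W = begin
    ∣ I ∣E + ∣ U ∣E                       ≡⟨ cong (_+ ∣ U ∣E) (∣∣-split I U) ⟩
    ∣ I ∩E U ∣E + ∣ I ∖E U ∣E + ∣ U ∣E     ≤⟨ +-monoˡ-≤ ∣ U ∣E (+-monoʳ-≤ ∣ I ∩E U ∣E (∣∣-mono I∖U⊆W∖U)) ⟩
    ∣ I ∩E U ∣E + ∣ W ∖E U ∣E + ∣ U ∣E     ≡⟨ +-assoc ∣ I ∩E U ∣E _ _ ⟩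
    ∣ I ∩E U ∣E + (∣ W ∖E U ∣E + ∣ U ∣E)   ≡⟨ cong (∣ I ∩E U ∣E +_) (+-comm _ ∣ U ∣E) ⟩
    ∣ I ∩E U ∣E + (∣ U ∣E + ∣ W ∖E U ∣E)   ≡⟨ cong (λ x → ∣ I ∩E U ∣E + (x + ∣ W ∖E U ∣E)) (sym (∣∣-cong (⊆⇒∩≈ U⊆W))) ⟩
    ∣ I ∩E U ∣E + (∣ W ∩E U ∣E + ∣ W ∖E U ∣E) ≡⟨ cong (∣ I ∩E U ∣E +_) (sym (∣∣-split W U)) ⟩
    ∣ I ∩E U ∣E + ∣ W ∣E                   ∎
    where
    open ≤-Reasoning
    I∖U⊆W∖U : (I ∖E U) ⊆E (W ∖E U)
    I∖U⊆W∖U i j h = ∧-intro (I⊆W i j (∧-elimˡ h)) (∧-elimʳ {I i j} h)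

  V₁-mono : {F G : ESet m n} → F ⊆E G → V₁ F ⊆V V₁ G
  V₁-mono h i = anyFin-mono n (h i)

  V₂-mono : {F G : ESet m n} → F ⊆E G → V₂ F ⊆V V₂ G
  V₂-mono h j = anyFin-mono m (λ i → h i j)

  K[]-mono : {F G : ESet m n} → F ⊆E G → K[ F ] ⊆E K[ G ]
  K[]-mono F⊆G = K⟨⟩-mono (V₁-mono F⊆G) (V₂-mono F⊆G)

  f₁₀-mono : {F G : ESet m n} → F ⊆E G → f₁₀ F ≤ f₁₀ G
  f₁₀-mono h = +-mono-≤ (count-mono m (V₁-mono h)) (count-mono n (V₂-mono h))

  f₁₀-cong : {F G : ESet m n} → F ≈E G → f₁₀ F ≡ f₁₀ G
  f₁₀-cong h = cong₂ _+_ (count-cong m (λ i → anyFin-cong n (h i)))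
                         (count-cong n (λ j → anyFin-cong m (λ i → h i j)))

  f₁₀-∅ : f₁₀ {m} {n} ∅E ≡ 0
  f₁₀-∅ = cong₂ _+_ (count-false m (λ _ → anyFin-false n)) (count-false n (λ _ → anyFin-false m))

  ⊆K[] : (F : ESet m n) → F ⊆E K[ F ]
  ⊆K[] F i j h = ∧-intro (anyFin-intro n (F i) j h) (anyFin-intro m (λ i → F i j) i h)

  V₁-⊆ : ∀ {F A B} → F ⊆E K⟨ A , B ⟩ → V₁ F ⊆V A
  V₁-⊆ {F} h i Vi = let (j , Fij) = anyFin-elim n (F i) Vi in ∧-elimˡ (h i j Fij)

  V₂-⊆ : ∀ {F A B} → F ⊆E K⟨ A , B ⟩ → V₂ F ⊆V B
  V₂-⊆ {F} {A} h j Vj = let (i , Fij) = anyFin-elim m (λ i → F i j) Vj in ∧-elimʳ {A i} (h i j Fij)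

  f₁₀-≤-K : ∀ {F A B} → F ⊆E K⟨ A , B ⟩ → f₁₀ F ≤ count m A + count n B
  f₁₀-≤-K h = +-mono-≤ (count-mono m (V₁-⊆ h)) (count-mono n (V₂-⊆ h))

  ∣∣≤∣K[]∣ : (F : ESet m n) → ∣ F ∣E ≤ count m (V₁ F) * count n (V₂ F)
  ∣∣≤∣K[]∣ F = subst (∣ F ∣E ≤_) (∣K∣ (V₁ F) (V₂ F)) (∣∣-mono (⊆K[] F))

  f₁₀-submodular : (F G : ESet m n) → f₁₀ (F ∪E G) + f₁₀ (F ∩E G) ≤ f₁₀ F + f₁₀ G
  f₁₀-submodular F G =
    subst₂ _≤_ (interchange (count m (V₁ (F ∪E G))) _ _ _) (interchange (count m (V₁ F)) _ _ _)
      (+-mono-≤ (side (V₁ F) (V₁ G) (V₁ (F ∪E G)) (V₁ (F ∩E G))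
                   (λ i → anyFin-∨ n (F i) (G i)) (V₁-mono ∩-⊆ˡ) (V₁-mono (∩-⊆ʳ {F})))
                (side (V₂ F) (V₂ G) (V₂ (F ∪E G)) (V₂ (F ∩E G))
                   (λ j → anyFin-∨ m (λ i → F i j) (λ i → G i j)) (V₂-mono ∩-⊆ˡ) (V₂-mono (∩-⊆ʳ {F}))))
    where
    side : ∀ {k} (p q u c : Fin k → Bool) → (∀ i → u i ≡ (p i ∨ q i)) → c ⊆V p → c ⊆V q →
           count k u + count k c ≤ count k p + count k q
    side {k} p q u c u≡ c⊆p c⊆q = subst (count k u + count k c ≤_) (count-∨+count-∧ k p q)
      (+-mono-≤ (≤-reflexive (count-cong k u≡)) (count-mono k (λ i ci → ∧-intro (c⊆p i ci) (c⊆q i ci))))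

  ⋃-⊆ : ∀ {K : ESet m n} S → All (_⊆E K) S → ⋃E S ⊆E K
  ⋃-⊆ []       _          i j ()
  ⋃-⊆ (X ∷ S) (X⊆ ∷ S⊆) = ∪-lub X⊆ (⋃-⊆ S S⊆)

  ProperFrom-anti : ∀ Xs {U U′ : ESet m n} → U′ ⊆E U → ProperFrom U Xs → ProperFrom U′ Xs
  ProperFrom-anti []       _    _          = tt
  ProperFrom-anti (X ∷ Xs) {U} U′⊆U (X⊈U , p) =
    (λ X⊆U′ → X⊈U (⊆-trans X⊆U′ U′⊆U)) ,
    ProperFrom-anti Xs (∪-lub (⊆-trans U′⊆U ∪-⊆ˡ) (∪-⊆ʳ {F = U})) p

  ProperFrom-++ : ∀ Xs Ys {U : ESet m n} →
    ProperFrom U Xs → ProperFrom (U ∪E ⋃E Xs) Ys → ProperFrom U (Xs ++ Ys)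
  ProperFrom-++ []       Ys {U} _          q = ProperFrom-anti Ys ∪-⊆ˡ q
  ProperFrom-++ (X ∷ Xs) Ys {U} (X⊈U , p) q = X⊈U , ProperFrom-++ Xs Ys p
    (ProperFrom-anti Ys (λ i j h → trans (sym (∨-assoc (U i j) (X i j) _)) h) q)

  edge⊆? : (F G : ESet m n) → ∀ i j → Dec (F i j ≡ true → G i j ≡ true)
  edge⊆? F G i j = (F i j Bool.≟ true) →-dec (G i j Bool.≟ true)

  _⊆?_ : (F G : ESet m n) → Dec (F ⊆E G)
  F ⊆? G = all? λ i → all? (edge⊆? F G i)

  ⊈⇒∃ : (F G : ESet m n) → ¬ (F ⊆E G) → ∃₂ λ i j → F i j ≡ true × G i j ≡ false
  ⊈⇒∃ F G F⊈G with ¬∀⟶∃¬ m _ (λ i → all? (edge⊆? F G i)) F⊈G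
  ... | i , ¬row with ¬∀⟶∃¬ n _ (edge⊆? F G i) ¬row
  ...   | j , ¬edge = i , j , witness (F i j) (G i j) ¬edge
    where
    witness : ∀ a b → ¬ (a ≡ true → b ≡ true) → a ≡ true × b ≡ false
    witness true  false _ = refl , refl
    witness true  true  h = ⊥-elim (h λ _ → refl)
    witness false _     h = ⊥-elim (h λ ())

  nonempty? : (F : ESet m n) → Dec (NonEmpty F)
  nonempty? F with any? (λ i → any? (λ j → F i j Bool.≟ true))
  ... | yes (i , j , Fij) = yes ((i , j) , Fij)
  ... | no  ¬∃            = no λ ((i , j) , Fij) → ¬∃ (i , j , Fij)

-- In any matroid, a proper sequence of circuits bounds the rank

module _ {m n : ℕ} {Ind : IndepPred {m} {n}} (M : IsMatroid Ind) where
  open IsMatroid M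

  augment-to : ∀ k {Q I} → Ind Q → Ind I → ∣ I ∣E ≤ ∣ Q ∣E + k →
    ∃ λ Q′ → Q ⊆E Q′ × Q′ ⊆E (Q ∪E I) × Ind Q′ × ∣ I ∣E ≤ ∣ Q′ ∣E
  augment-to zero {Q} IQ _ I≤Q = Q , ⊆-refl , ∪-⊆ˡ , IQ , subst (_ ≤_) (+-identityʳ _) I≤Q
  augment-to (suc k) {Q} {I} IQ II I≤Q+k with ∣ I ∣E ≤? ∣ Q ∣E
  ... | yes I≤Q = Q , ⊆-refl , ∪-⊆ˡ , IQ , I≤Q
  ... | no  I≰Q with indep-augment IQ II (≰⇒> I≰Q)
  ...   | (a , b) , Iab , Qab∉ , IQe with augment-to k IQe II
          (subst (∣ I ∣E ≤_) (trans (+-suc _ k) (cong (_+ k) (sym (∣∪⟦⟧∣ Q a b (¬-not Qab∉))))) I≤Q+k)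
  ...     | Q′ , Qe⊆Q′ , Q′⊆Qe∪I , IQ′ , I≤Q′ =
    Q′ , ⊆-trans (∪-⊆ˡ {G = e}) Qe⊆Q′ , ⊆-trans Q′⊆Qe∪I Qe∪I⊆Q∪I , IQ′ , I≤Q′
    where
    e : ESet m n
    e = ⟦ (a , b) ⟧E
    Qe∪I⊆Q∪I : ((Q ∪E e) ∪E I) ⊆E (Q ∪E I)
    Qe∪I⊆Q∪I = ∪-lub (∪-lub (∪-⊆ˡ {G = I}) (⊆-trans (⟦⟧-⊆ a b Iab) (∪-⊆ʳ {F = Q}))) (∪-⊆ʳ {F = Q})

  circuit-deletion : ∀ {C W I} (a : Fin m) (b : Fin n) → IsCircuit Ind C → C a b ≡ true → C ⊆E W →
    I ⊆E W → Ind I → ∃ λ I′ → I′ ⊆E (W ∖E ⟦ (a , b) ⟧E) × Ind I′ × ∣ I ∣E ≤ ∣ I′ ∣E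
  circuit-deletion {C} {W} {I} a b (C-dep , C-min) Cab C⊆W I⊆W II
    with augment-to ∣ I ∣E (C-min (C ∖E ⟦ (a , b) ⟧E) (∖-⊆ , (a , b) , Cab , a∉)) II (m≤n+m _ _)
    where
    a∉ : ¬ ((C ∖E ⟦ (a , b) ⟧E) a b ≡ true)
    a∉ h = true≢false (⟦⟧-self a b) (not-true⇒false (∧-elimʳ {C a b} h))
  ... | Q′ , C∖e⊆Q′ , Q′⊆ , IQ′ , I≤Q′ = Q′ , Q′⊆W∖e , IQ′ , I≤Q′
    where
    Q′⊆W : Q′ ⊆E W
    Q′⊆W = ⊆-trans Q′⊆ (∪-lub (⊆-trans ∖-⊆ C⊆W) I⊆W)
    e∉Q′ : Q′ a b ≡ true → ⊥
    e∉Q′ Q′ab = C-dep (indep-down (⊆-trans ⊆∖∪ (∪-lub C∖e⊆Q′ (⟦⟧-⊆ a b Q′ab))) IQ′)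
    Q′⊆W∖e : Q′ ⊆E (W ∖E ⟦ (a , b) ⟧E)
    Q′⊆W∖e i j Q′ij = ∧-intro (Q′⊆W i j Q′ij) (cong not (¬-not λ e → e∉Q′ (at e)))
      where
      at : ⟦ (a , b) ⟧E i j ≡ true → Q′ a b ≡ true
      at e with ⟦⟧⇒≡ {a = a} {i} {b} {j} e
      ... | refl , refl = Q′ij

  circuit-step : ∀ {X U I} → IsCircuit Ind X → ¬ (X ⊆E U) → I ⊆E (U ∪E X) → Ind I →
    ∃ λ I′ → I′ ⊆E U × Ind I′ × ∣ I ∣E + ∣ U ∣E + 1 ≤ ∣ I′ ∣E + ∣ U ∪E X ∣E
  circuit-step {X} {U} {I} circX X⊈U I⊆U∪X II with ⊈⇒∃ X U X⊈U
  ... | a , b , Xab , Uab with circuit-deletion a b circX Xab (∪-⊆ʳ {F = U}) I⊆U∪X II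
  ...   | I* , I*⊆W∖e , II* , I≤I* =
    I* ∩E U , ∩-⊆ʳ {F = I*} , indep-down ∩-⊆ˡ II* , (begin
      ∣ I ∣E + ∣ U ∣E + 1            ≤⟨ +-monoˡ-≤ 1 (+-monoˡ-≤ ∣ U ∣E I≤I*) ⟩
      ∣ I* ∣E + ∣ U ∣E + 1           ≤⟨ +-monoˡ-≤ 1 (restriction-bound U⊆W∖e I*⊆W∖e) ⟩
      ∣ I* ∩E U ∣E + ∣ W∖e ∣E + 1    ≡⟨ +-assoc ∣ I* ∩E U ∣E _ 1 ⟩
      ∣ I* ∩E U ∣E + (∣ W∖e ∣E + 1)  ≡⟨ cong (∣ I* ∩E U ∣E +_) (+-comm _ 1) ⟩
      ∣ I* ∩E U ∣E + suc ∣ W∖e ∣E    ≡⟨ cong (∣ I* ∩E U ∣E +_) (sym (∣∖⟦⟧∣ (U ∪E X) a b (∨-introʳ (U a b) Xab))) ⟩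
      ∣ I* ∩E U ∣E + ∣ U ∪E X ∣E     ∎)
    where
    open ≤-Reasoning
    W∖e : ESet m n
    W∖e = (U ∪E X) ∖E ⟦ (a , b) ⟧E
    U⊆W∖e : U ⊆E W∖e
    U⊆W∖e i j Uij = ∧-intro (∪-⊆ˡ {F = U} {G = X} i j Uij) (cong not (¬-not λ e → true≢false (at e) Uab))
      where
      at : ⟦ (a , b) ⟧E i j ≡ true → U a b ≡ true
      at e with ⟦⟧⇒≡ {a = a} {i} {b} {j} e
      ... | refl , refl = Uij

  proper-circuits-bound : ∀ Xs {U I} → All (IsCircuit Ind) Xs → ProperFrom U Xs →
    I ⊆E (U ∪E ⋃E Xs) → Ind I →
    ∃ λ I′ → I′ ⊆E U × Ind I′ × ∣ I ∣E + ∣ U ∣E + length Xs ≤ ∣ I′ ∣E + ∣ U ∪E ⋃E Xs ∣E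
  proper-circuits-bound [] {U} {I} _ _ I⊆U∪∅ II =
    I , (λ i j h → trans (sym (∨-identityʳ (U i j))) (I⊆U∪∅ i j h)) , II ,
    ≤-reflexive (trans (+-identityʳ _) (cong (∣ I ∣E +_) (∣∣-cong (λ i j → sym (∨-identityʳ (U i j))))))
  proper-circuits-bound (X ∷ Xs) {U} {I} (circX ∷ circXs) (X⊈U , proper) I⊆ II
    with proper-circuits-bound Xs circXs proper (λ i j h → trans (∨-assoc (U i j) (X i j) _) (I⊆ i j h)) II
  ... | I₁ , I₁⊆U∪X , II₁ , bound₁ with circuit-step circX X⊈U I₁⊆U∪X II₁
  ...   | I₂ , I₂⊆U , II₂ , bound₂ =
    I₂ , I₂⊆U , II₂ ,
    subst (λ z → ∣ I ∣E + ∣ U ∣E + suc (length Xs) ≤ ∣ I₂ ∣E + z)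
      (∣∣-cong (λ i j → ∨-assoc (U i j) (X i j) _))
      (arith ∣ I ∣E ∣ U ∣E (length Xs) ∣ I₁ ∣E ∣ I₂ ∣E ∣ U ∪E X ∣E _ bound₁ bound₂)
    where
    arith : ∀ a u l b c w z → a + w + l ≤ b + z → b + u + 1 ≤ c + w → a + u + suc l ≤ c + z
    arith a u l b c w z h₁ h₂ = +-cancelˡ-≤ (b + w) _ _
      (subst₂ _≤_ (lhs a u l b w) (rhs b c w z) (+-mono-≤ h₁ h₂))
      where
      lhs : ∀ a u l b w → (a + w + l) + (b + u + 1) ≡ (b + w) + (a + u + suc l)
      lhs = solve-∀
      rhs : ∀ b c w z → (b + z) + (c + w) ≡ (b + w) + (c + z)
      rhs = solve-∀

  circuit-nonempty : ∀ {X} → IsCircuit Ind X → ¬ (X ⊆E ∅E)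
  circuit-nonempty (X-dep , _) X⊆∅ = X-dep (indep-down X⊆∅ indep-∅)

  circuit-sequence-bound : ∀ {F I} S → All (IsCircuit Ind) S → ProperSeq S → I ⊆E F → Ind I →
    ∣ I ∣E + length S ≤ ∣ F ∪E ⋃E S ∣E
  circuit-sequence-bound {F} {I} S circS properS I⊆F II
    with proper-circuits-bound S circS (from-∅ S circS properS) (∩-⊆ʳ {F = I}) (indep-down ∩-⊆ˡ II)
    where
    from-∅ : ∀ S → All (IsCircuit Ind) S → ProperSeq S → ProperFrom ∅E S
    from-∅ []      _           _ = tt
    from-∅ (X ∷ _) (circX ∷ _) p = circuit-nonempty circX , p
  ... | I′ , I′⊆∅ , _ , bound = +-cancelʳ-≤ ∣ ⋃E S ∣E _ _ (begin
    ∣ I ∣E + length S + ∣ ⋃E S ∣E                 ≡⟨ xy∙z≈xz∙y ∣ I ∣E (length S) _ ⟩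
    ∣ I ∣E + ∣ ⋃E S ∣E + length S                 ≤⟨ +-monoˡ-≤ (length S) (restriction-bound ∪-⊆ʳ (⊆-trans I⊆F ∪-⊆ˡ)) ⟩
    ∣ I ∩E ⋃E S ∣E + ∣ F ∪E ⋃E S ∣E + length S    ≡⟨ xy∙z≈xz∙y ∣ I ∩E ⋃E S ∣E _ (length S) ⟩
    ∣ I ∩E ⋃E S ∣E + length S + ∣ F ∪E ⋃E S ∣E    ≤⟨ +-monoˡ-≤ ∣ F ∪E ⋃E S ∣E (subst₂ _≤_ lhs rhs bound) ⟩
    ∣ ⋃E S ∣E + ∣ F ∪E ⋃E S ∣E                    ≡⟨ +-comm ∣ ⋃E S ∣E _ ⟩
    ∣ F ∪E ⋃E S ∣E + ∣ ⋃E S ∣E                    ∎)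
    where
    open ≤-Reasoning
    lhs : ∣ I ∩E ⋃E S ∣E + ∣ ∅E {m} {n} ∣E + length S ≡ ∣ I ∩E ⋃E S ∣E + length S
    lhs = cong (_+ length S) (trans (cong (∣ I ∩E ⋃E S ∣E +_) (∣∣-false {F = ∅E {m} {n}} (λ _ _ → refl))) (+-identityʳ _))
    rhs : ∣ I′ ∣E + ∣ ⋃E S ∣E ≡ ∣ ⋃E S ∣E
    rhs = cong (_+ ∣ ⋃E S ∣E) (∣∣-false (λ i j → ¬-not λ h → true≢false (I′⊆∅ i j h) refl))

  val-bound : ∀ {F I} S → All (IsCircuit Ind) S → ProperSeq S → I ⊆E F → Ind I → ∣ I ∣E ≤ val F S
  val-bound S circS properS I⊆F II = m+n≤o⇒m≤o∸n _ (circuit-sequence-bound S circS properS I⊆F II)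

consF : ∀ {A : Set} {k} → A → (Fin k → A) → Fin (suc k) → A
consF a f zero    = a
consF a f (suc i) = f i

functions : ∀ {A : Set} k → List A → List (Fin k → A)
functions zero    L = (λ ()) ∷ []
functions (suc k) L = cartesianProductWith consF L (functions k L)

functions-complete : ∀ {A : Set} (R : A → A → Set) (L : List A) → (∀ a → ∃ λ b → b ∈ L × R a b) →
  ∀ k (f : Fin k → A) → ∃ λ g → g ∈ functions k L × (∀ i → R (f i) (g i))
functions-complete R L complete zero    f = (λ ()) , here refl , λ ()
functions-complete R L complete (suc k) f
  with complete (f zero) | functions-complete R L complete k (λ i → f (suc i))
... | b , b∈L , Rb | g , g∈ , Rg =
  consF b g , ∈-cartesianProductWith⁺ consF b∈L g∈ , λ { zero → Rb ; (suc i) → Rg i }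

search-list : ∀ {A : Set} (P N : A → Set) → (∀ a → P a ⊎ N a) → (L : List A) → (∀ {a} → a ∈ L → P a) ⊎ ∃ N
search-list P N decide []      = inj₁ λ ()
search-list P N decide (x ∷ L) with decide x | search-list P N decide L
... | inj₂ Nx | _         = inj₂ (x , Nx)
... | inj₁ _  | inj₂ N∃   = inj₂ N∃
... | inj₁ Px | inj₁ P∀   = inj₁ λ { (here refl) → Px ; (there a∈) → P∀ a∈ }

module _ {m n : ℕ} where

  allESets : List (ESet m n)
  allESets = functions m (functions n (true ∷ false ∷ []))

  -- Only up to ≈E: without function extensionality F itself need not occur in the list.
  allESets-complete : (F : ESet m n) → ∃ λ G → G ∈ allESets × F ≈E G
  allESets-complete F = functions-complete (λ r r′ → ∀ j → r j ≡ r′ j) _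
    (functions-complete _≡_ _ (λ { true → true , here refl , refl ; false → false , there (here refl) , refl }) n) m F

  search-ESet : (P N : ESet m n → Set) → (∀ I → P I ⊎ N I) → (∀ {I J} → I ≈E J → P J → P I) →
    (∀ I → P I) ⊎ ∃ N
  search-ESet P N decide respects with search-list P N decide allESets
  ... | inj₂ N∃ = inj₂ N∃
  ... | inj₁ P∀ = inj₁ λ I → let (G , G∈ , I≈G) = allESets-complete I in respects I≈G (P∀ G∈)

  allEdges : List (Fin m × Fin n)
  allEdges = cartesianProduct (allFin m) (allFin n)

  allEdges-complete : (e : Fin m × Fin n) → e ∈ allEdges
  allEdges-complete (i , j) = ∈-cartesianProduct⁺ (∈-allFin i) (∈-allFin j)

-- M_f₁₀ is a matroid

module _ {m n : ℕ} where

  Indep-f₁₀⇒≤f₁₀ : {F : ESet m n} → Indep-f₁₀ F → ∀ I → I ⊆E F → ∣ I ∣E ≤ f₁₀ I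
  Indep-f₁₀⇒≤f₁₀ IF I I⊆F with nonempty? I
  ... | yes ne = IF I I⊆F ne
  ... | no ¬ne = subst (_≤ f₁₀ I) (sym (∣∣-false λ i j → ¬-not λ h → ¬ne ((i , j) , h))) z≤n

  indep-f₁₀? : (F : ESet m n) → Indep-f₁₀ F ⊎ ∃ λ J → J ⊆E F × f₁₀ J < ∣ J ∣E
  indep-f₁₀? F with search-ESet (λ I → I ⊆E F → ∣ I ∣E ≤ f₁₀ I) _ decide respects
    where
    decide : ∀ I → (I ⊆E F → ∣ I ∣E ≤ f₁₀ I) ⊎ (I ⊆E F × f₁₀ I < ∣ I ∣E)
    decide I with ∣ I ∣E ≤? f₁₀ I | I ⊆? F
    ... | yes I≤f | _       = inj₁ λ _ → I≤f
    ... | no  I≰f | yes I⊆F = inj₂ (I⊆F , ≰⇒> I≰f)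
    ... | no  _   | no  I⊈F = inj₁ λ I⊆F → ⊥-elim (I⊈F I⊆F)
    respects : ∀ {I J} → I ≈E J → (J ⊆E F → ∣ J ∣E ≤ f₁₀ J) → I ⊆E F → ∣ I ∣E ≤ f₁₀ I
    respects I≈J bound I⊆F = subst₂ _≤_ (sym (∣∣-cong I≈J)) (sym (f₁₀-cong I≈J))
      (bound λ i j Jij → I⊆F i j (trans (I≈J i j) Jij))
  ... | inj₁ bounded  = inj₁ λ I I⊆F _ → bounded I I⊆F
  ... | inj₂ violated = inj₂ violated

  Tight : ESet m n → Set
  Tight T = f₁₀ T ≤ ∣ T ∣E

  tight-∅ : Tight ∅E
  tight-∅ = ≤-reflexive (trans (f₁₀-∅ {m} {n}) (sym (∣∣-false {F = ∅E {m} {n}} λ _ _ → refl)))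

  tight-∪ : ∀ {F T₁ T₂} → Indep-f₁₀ F → T₁ ⊆E F → Tight T₁ → Tight T₂ → Tight (T₁ ∪E T₂)
  tight-∪ {F} {T₁} {T₂} IF T₁⊆F t₁ t₂ = +-cancelʳ-≤ (f₁₀ (T₁ ∩E T₂)) _ _ (begin
    f₁₀ (T₁ ∪E T₂) + f₁₀ (T₁ ∩E T₂)    ≤⟨ f₁₀-submodular T₁ T₂ ⟩
    f₁₀ T₁ + f₁₀ T₂                    ≤⟨ +-mono-≤ t₁ t₂ ⟩
    ∣ T₁ ∣E + ∣ T₂ ∣E                  ≡⟨ sym (∣∪∣+∣∩∣ T₁ T₂) ⟩
    ∣ T₁ ∪E T₂ ∣E + ∣ T₁ ∩E T₂ ∣E      ≤⟨ +-monoʳ-≤ ∣ T₁ ∪E T₂ ∣E (Indep-f₁₀⇒≤f₁₀ IF _ (⊆-trans ∩-⊆ˡ T₁⊆F)) ⟩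
    ∣ T₁ ∪E T₂ ∣E + f₁₀ (T₁ ∩E T₂)     ∎)
    where open ≤-Reasoning

  f₁₀-≤⇒V-⊆ : {T J : ESet m n} → T ⊆E J → f₁₀ J ≤ f₁₀ T → V₁ J ⊆V V₁ T × V₂ J ⊆V V₂ T
  f₁₀-≤⇒V-⊆ {T} {J} T⊆J J≤T =
    count-⊆-≡⇒⊇ m (V₁-mono T⊆J) (≤-antisym v₁≤ (+-cancelʳ-≤ v₂′ v₁′ v₁ (≤-trans J≤T (+-monoʳ-≤ v₁ v₂≤)))) ,
    count-⊆-≡⇒⊇ n (V₂-mono T⊆J) (≤-antisym v₂≤ (+-cancelˡ-≤ v₁′ v₂′ v₂ (≤-trans J≤T (+-monoˡ-≤ v₂ v₁≤))))
    where
    v₁ v₂ v₁′ v₂′ : ℕ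
    v₁ = count m (V₁ T)
    v₂ = count n (V₂ T)
    v₁′ = count m (V₁ J)
    v₂′ = count n (V₂ J)
    v₁≤ : v₁ ≤ v₁′
    v₁≤ = count-mono m (V₁-mono T⊆J)
    v₂≤ : v₂ ≤ v₂′
    v₂≤ = count-mono n (V₂-mono T⊆J)

  violation⇒tight : ∀ {F J} (a : Fin m) (b : Fin n) → Indep-f₁₀ F → F a b ≡ false →
    J ⊆E (F ∪E ⟦ (a , b) ⟧E) → f₁₀ J < ∣ J ∣E →
    (J ∩E F) ⊆E F × Tight (J ∩E F) × K[ J ∩E F ] a b ≡ true
  violation⇒tight {F} {J} a b IF Fab J⊆F+e fJ<J with true⊎false (J a b)
  ... | inj₂ Jab = ⊥-elim (<⇒≱ fJ<J (Indep-f₁₀⇒≤f₁₀ IF J J⊆F))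
    where
    J⊆F : J ⊆E F
    J⊆F i j Jij with ∨-elim {F i j} (J⊆F+e i j Jij)
    ... | inj₁ Fij = Fij
    ... | inj₂ e with ⟦⟧⇒≡ {a = a} {i} {b} {j} e
    ...   | refl , refl = ⊥-elim (true≢false Jij Jab)
  ... | inj₁ Jab = ∩-⊆ʳ {F = J} , ≤-trans (f₁₀-mono (∩-⊆ˡ {G = F})) fJ≤T ,
                   ∧-intro (proj₁ V[J]⊆V[T] a (anyFin-intro n (J a) b Jab)) (proj₂ V[J]⊆V[T] b (anyFin-intro m (λ i → J i b) a Jab))
    where
    T : ESet m n
    T = J ∩E F
    J∖F⊆e : (J ∖E F) ⊆E ⟦ (a , b) ⟧E
    J∖F⊆e i j h with ∨-elim {F i j} (J⊆F+e i j (∧-elimˡ h))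
    ... | inj₂ e   = e
    ... | inj₁ Fij = ⊥-elim (true≢false Fij (not-true⇒false (∧-elimʳ {J i j} h)))
    J≤T+1 : ∣ J ∣E ≤ ∣ T ∣E + 1
    J≤T+1 = subst (_≤ ∣ T ∣E + 1) (sym (∣∣-split J F))
      (+-monoʳ-≤ ∣ T ∣E (subst (∣ J ∖E F ∣E ≤_) (∣⟦⟧∣≡1 (a , b)) (∣∣-mono J∖F⊆e)))
    fJ≤T : f₁₀ J ≤ ∣ T ∣E
    fJ≤T = +-cancelʳ-≤ 1 (f₁₀ J) ∣ T ∣E (subst (_≤ ∣ T ∣E + 1) (+-comm 1 (f₁₀ J)) (≤-trans fJ<J J≤T+1))
    V[J]⊆V[T] : V₁ J ⊆V V₁ T × V₂ J ⊆V V₂ T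
    V[J]⊆V[T] = f₁₀-≤⇒V-⊆ (∩-⊆ˡ {G = F}) (≤-trans fJ≤T (Indep-f₁₀⇒≤f₁₀ IF T (∩-⊆ʳ {F = J})))

  Augmentable : ESet m n → ESet m n → Set
  Augmentable F P = ∃ λ e → (e ∈E P) × ¬ (e ∈E F) × Indep-f₁₀ (F ∪E ⟦ e ⟧E)

  TightCover : ESet m n → ESet m n → Set
  TightCover F P = ∃ λ T → T ⊆E F × Tight T × P ⊆E (F ∪E K[ T ])

  augmentable-or-tight-cover : {F : ESet m n} → Indep-f₁₀ F → (P : ESet m n) →
    Augmentable F P ⊎ TightCover F P
  augmentable-or-tight-cover {F} IF P with go allEdges
    where
    go : (L : List (Fin m × Fin n)) → Augmentable F P ⊎
         ∃ λ T → T ⊆E F × Tight T × (∀ {i j} → (i , j) ∈ L → P i j ≡ true → (F ∪E K[ T ]) i j ≡ true)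
    go [] = inj₂ (∅E , (λ _ _ ()) , tight-∅ , λ ())
    go ((a , b) ∷ L) with go L
    ... | inj₁ aug = inj₁ aug
    ... | inj₂ (T , T⊆F , tightT , covL) with true⊎false (F a b) | indep-f₁₀? (F ∪E ⟦ (a , b) ⟧E)
    ...   | inj₁ Fab | _ = inj₂ (T , T⊆F , tightT ,
            λ { (here refl) _ → ∨-introˡ _ Fab ; (there e∈) → covL e∈ })
    ...   | inj₂ Fab | inj₁ IFe with true⊎false (P a b)
    ...     | inj₁ Pab = inj₁ ((a , b) , Pab , (λ h → true≢false h Fab) , IFe)
    ...     | inj₂ Pab = inj₂ (T , T⊆F , tightT ,
              λ { (here refl) h → ⊥-elim (true≢false h Pab) ; (there e∈) → covL e∈ })
    go ((a , b) ∷ L) | inj₂ (T , T⊆F , tightT , covL) | inj₂ Fab | inj₂ (J , J⊆F+e , fJ<J)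
      with violation⇒tight a b IF Fab J⊆F+e fJ<J
    ... | T′⊆F , tightT′ , e∈K[T′] =
      inj₂ (T ∪E (J ∩E F) , ∪-lub T⊆F T′⊆F , tight-∪ IF T⊆F tightT tightT′ ,
            λ { (here refl) _ → ∨-introʳ (F a b) (K[]-mono (∪-⊆ʳ {F = T}) a b e∈K[T′])
              ; (there e∈) Pe → F∪K[T]⊆ _ _ (covL e∈ Pe) })
      where
      F∪K[T]⊆ : (F ∪E K[ T ]) ⊆E (F ∪E K[ T ∪E (J ∩E F) ])
      F∪K[T]⊆ = ∪-lub (∪-⊆ˡ {G = K[ T ∪E (J ∩E F) ]}) (⊆-trans (K[]-mono ∪-⊆ˡ) (∪-⊆ʳ {F = F}))
  ... | inj₁ aug                    = inj₁ aug
  ... | inj₂ (T , T⊆F , tightT , cov) = inj₂ (T , T⊆F , tightT , λ i j → cov (allEdges-complete (i , j)))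

  tight-cover-bound : ∀ {F G T} → Indep-f₁₀ G → T ⊆E F → Tight T → G ⊆E (F ∪E K[ T ]) → ∣ G ∣E ≤ ∣ F ∣E
  tight-cover-bound {F} {G} {T} IG T⊆F tightT G⊆F∪K = begin
    ∣ G ∣E                             ≡⟨ ∣∣-split G K[ T ] ⟩
    ∣ G ∩E K[ T ] ∣E + ∣ G ∖E K[ T ] ∣E ≤⟨ +-mono-≤ G∩K≤T (∣∣-mono G∖K⊆F∖T) ⟩
    ∣ T ∣E + ∣ F ∖E T ∣E               ≡⟨ cong (_+ ∣ F ∖E T ∣E) (sym (∣∣-cong (⊆⇒∩≈ T⊆F))) ⟩
    ∣ F ∩E T ∣E + ∣ F ∖E T ∣E          ≡⟨ sym (∣∣-split F T) ⟩
    ∣ F ∣E                             ∎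
    where
    open ≤-Reasoning
    G∩K≤T : ∣ G ∩E K[ T ] ∣E ≤ ∣ T ∣E
    G∩K≤T = ≤-trans (Indep-f₁₀⇒≤f₁₀ IG _ ∩-⊆ˡ) (≤-trans (f₁₀-≤-K (∩-⊆ʳ {F = G})) tightT)
    G∖K⊆F∖T : (G ∖E K[ T ]) ⊆E (F ∖E T)
    G∖K⊆F∖T i j h with ∨-elim {F i j} (G⊆F∪K i j (∧-elimˡ h))
    ... | inj₂ Kij = ⊥-elim (true≢false Kij (not-true⇒false (∧-elimʳ {G i j} h)))
    ... | inj₁ Fij = ∧-intro Fij (cong not (¬-not λ Tij →
                       true≢false (⊆K[] T i j Tij) (not-true⇒false (∧-elimʳ {G i j} h))))

  f₁₀-matroid : IsMatroid (Indep-f₁₀ {m} {n})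
  f₁₀-matroid = record
    { indep-∅       = λ I I⊆∅ ((i , j) , Iij) → ⊥-elim (true≢false (I⊆∅ i j Iij) refl)
    ; indep-down    = λ F⊆G IG I I⊆F → IG I (⊆-trans I⊆F F⊆G)
    ; indep-augment = augment
    }
    where
    augment : ∀ {F G} → Indep-f₁₀ F → Indep-f₁₀ G → ∣ F ∣E < ∣ G ∣E → Augmentable F G
    augment IF IG F<G with augmentable-or-tight-cover IF _
    ... | inj₁ aug                       = aug
    ... | inj₂ (T , T⊆F , tightT , G⊆) = ⊥-elim (<⇒≱ F<G (tight-cover-bound IG T⊆F tightT G⊆))

  record CertifiedBasis (F : ESet m n) : Set where
    field
      basis       : ESet m n
      basis-⊆     : basis ⊆E F
      basis-indep : Indep-f₁₀ basis
      core        : ESet m n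
      core-⊆      : core ⊆E basis
      core-tight  : Tight core
      covers      : F ⊆E (basis ∪E K[ core ])

  grow-basis : ∀ k {F B} → B ⊆E F → Indep-f₁₀ B → ∣ F ∣E ≤ ∣ B ∣E + k → CertifiedBasis F
  grow-basis k {F} {B} B⊆F IB F≤B+k with augmentable-or-tight-cover IB F | k
  ... | inj₂ (T , T⊆B , tightT , F⊆) | _ = record
    { basis = B ; basis-⊆ = B⊆F ; basis-indep = IB
    ; core = T ; core-⊆ = T⊆B ; core-tight = tightT ; covers = F⊆ }
  ... | inj₁ ((a , b) , Fab , Bab∉ , IBe) | zero =
    ⊥-elim (<⇒≱ (subst (_≤ ∣ F ∣E) (∣∪⟦⟧∣ B a b (¬-not Bab∉)) (∣∣-mono Be⊆F))
                (subst (∣ F ∣E ≤_) (+-identityʳ _) F≤B+k))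
    where
    Be⊆F : (B ∪E ⟦ (a , b) ⟧E) ⊆E F
    Be⊆F = ∪-lub B⊆F (⟦⟧-⊆ a b Fab)
  ... | inj₁ ((a , b) , Fab , Bab∉ , IBe) | suc k′ =
    grow-basis k′ (∪-lub B⊆F (⟦⟧-⊆ a b Fab)) IBe
      (subst (∣ F ∣E ≤_) (trans (+-suc _ k′) (cong (_+ k′) (sym (∣∪⟦⟧∣ B a b (¬-not Bab∉))))) F≤B+k)

  certifiedBasis : (F : ESet m n) → CertifiedBasis F
  certifiedBasis F = grow-basis ∣ F ∣E (λ _ _ ()) (IsMatroid.indep-∅ f₁₀-matroid) (m≤n+m _ _)

-- Copies of K_{2,3} are circuits of M_f₁₀

Is2×3 : ℕ → ℕ → Set
Is2×3 a b = (a ≡ 2 × b ≡ 3) ⊎ (a ≡ 3 × b ≡ 2)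

2×3-positive : ∀ {a b} → Is2×3 a b → 0 < a × 0 < b
2×3-positive (inj₁ (refl , refl)) = s≤s z≤n , s≤s z≤n
2×3-positive (inj₂ (refl , refl)) = s≤s z≤n , s≤s z≤n

2×3-sum<product : ∀ {a b} → Is2×3 a b → a + b < a * b
2×3-sum<product (inj₁ (refl , refl)) = ≤-refl
2×3-sum<product (inj₂ (refl , refl)) = ≤-refl

product≤sum-or-2×3 : ∀ x y → x ≤ 2 → y ≤ 3 → x * y ≤ x + y ⊎ (x ≡ 2 × y ≡ 3)
product≤sum-or-2×3 0 y _ _ = inj₁ z≤n
product≤sum-or-2×3 1 y _ _ = inj₁ (≤-trans (≤-reflexive (+-identityʳ y)) (n≤1+n y))
product≤sum-or-2×3 2 0 _ _ = inj₁ z≤n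
product≤sum-or-2×3 2 1 _ _ = inj₁ (s≤s (s≤s z≤n))
product≤sum-or-2×3 2 2 _ _ = inj₁ ≤-refl
product≤sum-or-2×3 2 3 _ _ = inj₂ (refl , refl)
product≤sum-or-2×3 2 (suc (suc (suc (suc y)))) _ (s≤s (s≤s (s≤s ())))
product≤sum-or-2×3 (suc (suc (suc x))) y (s≤s (s≤s ())) _

product≤sum-below-2×3 : ∀ {a b} x y → Is2×3 a b → x ≤ a → y ≤ b →
  x * y ≤ x + y ⊎ (x ≡ a × y ≡ b × x * y ≡ suc (x + y))
product≤sum-below-2×3 x y (inj₁ (refl , refl)) x≤a y≤b with product≤sum-or-2×3 x y x≤a y≤b
... | inj₁ xy≤ = inj₁ xy≤
... | inj₂ (refl , refl) = inj₂ (refl , refl , refl)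
product≤sum-below-2×3 x y (inj₂ (refl , refl)) x≤a y≤b with product≤sum-or-2×3 y x y≤b x≤a
... | inj₁ yx≤ = inj₁ (subst₂ _≤_ (*-comm y x) (+-comm y x) yx≤)
... | inj₂ (refl , refl) = inj₂ (refl , refl , refl)

module _ {m n : ℕ} where

  K23-dependent : {X : ESet m n} {A : Fin m → Bool} {B : Fin n → Bool} →
    Is2×3 (count m A) (count n B) → X ≈E K⟨ A , B ⟩ → ¬ Indep-f₁₀ X
  K23-dependent {X} {A} {B} sizes X≈K IX
    with count-pos m A (proj₁ (2×3-positive sizes)) | count-pos n B (proj₂ (2×3-positive sizes))
  ... | i , Ai | j , Bj = <⇒≱ (2×3-sum<product sizes) (begin
    count m A * count n B ≡⟨ sym (trans (∣∣-cong X≈K) (∣K∣ A B)) ⟩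
    ∣ X ∣E                ≤⟨ IX X ⊆-refl ((i , j) , trans (X≈K i j) (∧-intro Ai Bj)) ⟩
    f₁₀ X                 ≤⟨ f₁₀-≤-K (≈⇒⊆ X≈K) ⟩
    count m A + count n B ∎)
    where open ≤-Reasoning

  -- A subgraph with more edges than vertices would have to span the whole 2 × 3 box, yet it misses an edge.
  K23-proper-subsets-independent : {X : ESet m n} {A : Fin m → Bool} {B : Fin n → Bool} →
    Is2×3 (count m A) (count n B) → X ⊆E K⟨ A , B ⟩ → ∀ D → D ⊂E X → Indep-f₁₀ D
  K23-proper-subsets-independent {X} {A} {B} sizes X⊆K D (D⊆X , (a , b) , Xab , Dab∉) I I⊆D _
    with product≤sum-below-2×3 (count m (V₁ I)) (count n (V₂ I)) sizes
           (count-mono m (V₁-⊆ I⊆K)) (count-mono n (V₂-⊆ I⊆K))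
    where
    I⊆K : I ⊆E K⟨ A , B ⟩
    I⊆K = ⊆-trans I⊆D (⊆-trans D⊆X X⊆K)
  ... | inj₁ small = ≤-trans (∣∣≤∣K[]∣ I) small
  ... | inj₂ (V₁≡A , V₂≡B , full) =
    ≤-pred (subst (suc ∣ I ∣E ≤_) (trans (∣K∣ (V₁ I) (V₂ I)) full)
      (∣∣-mono-< (⊆K[] I) a b (K⟨⟩-mono A⊆V₁ B⊆V₂ a b (X⊆K a b Xab)) (¬-not λ Iab → Dab∉ (I⊆D a b Iab))))
    where
    I⊆K : I ⊆E K⟨ A , B ⟩
    I⊆K = ⊆-trans I⊆D (⊆-trans D⊆X X⊆K)
    A⊆V₁ : A ⊆V V₁ I
    A⊆V₁ = count-⊆-≡⇒⊇ m (V₁-⊆ I⊆K) V₁≡A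
    B⊆V₂ : B ⊆V V₂ I
    B⊆V₂ = count-⊆-≡⇒⊇ n (V₂-⊆ I⊆K) V₂≡B

  K23-circuit : (X : ESet m n) → IsK23 X → IsCircuit (Indep-f₁₀ {m} {n}) X
  K23-circuit X (A , B , sizes , X≈K) =
    K23-dependent sizes X≈K , K23-proper-subsets-independent sizes (≈⇒⊆ X≈K)

-- Long proper K_{2,3}-sequences in complete bipartite graphs

remove : ∀ {k} → (Fin k → Bool) → Fin k → Fin k → Bool
remove A r i = A i ∧ not (i ≡ᵇ r)

remove-⊆ : ∀ {k} (A : Fin k → Bool) r → remove A r ⊆V A
remove-⊆ A r i = ∧-elimˡ

remove-self : ∀ {k} (A : Fin k → Bool) r → remove A r r ≡ false
remove-self A r = trans (cong (λ z → A r ∧ not z) (≡ᵇ-refl r)) (∧-zeroʳ (A r))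

remove-≢ : ∀ {k} (A : Fin k → Bool) r {i} → remove A r i ≡ true → i ≢ r
remove-≢ A r h refl = true≢false h (remove-self A r)

count-remove : ∀ k (A : Fin k → Bool) r → A r ≡ true → count k A ≡ suc (count k (remove A r))
count-remove k A r Ar = trans (count-split k A (_≡ᵇ r))
  (cong (_+ count k (remove A r)) (count-unique k r (∧-intro Ar (≡ᵇ-refl r)) (λ i h → ≡ᵇ⇒≡ (∧-elimʳ {A i} h))))

choose : ∀ k (A : Fin k → Bool) c → count k A ≡ suc c → ∃ λ r → A r ≡ true × count k (remove A r) ≡ c
choose k A c A≡ with count-pos k A (subst (0 <_) (sym A≡) (s≤s z≤n))
... | r , Ar = r , Ar , suc-injective (trans (sym (count-remove k A r Ar)) A≡)

choose-two : ∀ k (A : Fin k → Bool) c → count k A ≡ suc (suc c) →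
  ∃₂ λ r₁ r₂ → A r₁ ≡ true × A r₂ ≡ true × r₂ ≢ r₁
choose-two k A c A≡ with choose k A (suc c) A≡
... | r₁ , Ar₁ , A′≡ with choose k (remove A r₁) c A′≡
...   | r₂ , A′r₂ , _ = r₁ , r₂ , Ar₁ , remove-⊆ A r₁ r₂ A′r₂ , remove-≢ A r₁ A′r₂

count-insert : ∀ k (p : Fin k → Bool) z → p z ≡ false → count k (λ i → p i ∨ (i ≡ᵇ z)) ≡ suc (count k p)
count-insert k p z pz = begin
  count k (λ i → p i ∨ (i ≡ᵇ z))                              ≡⟨ sym (+-identityʳ _) ⟩
  count k (λ i → p i ∨ (i ≡ᵇ z)) + 0                          ≡⟨ cong (count k (λ i → p i ∨ (i ≡ᵇ z)) +_) (sym disjoint) ⟩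
  count k (λ i → p i ∨ (i ≡ᵇ z)) + count k (λ i → p i ∧ (i ≡ᵇ z)) ≡⟨ count-∨+count-∧ k p (_≡ᵇ z) ⟩
  count k p + count k (_≡ᵇ z)                                  ≡⟨ cong (count k p +_) (count-≡ᵇ k z) ⟩
  count k p + 1                                                ≡⟨ +-comm (count k p) 1 ⟩
  suc (count k p)                                              ∎
  where
  open ≡-Reasoning
  disjoint : count k (λ i → p i ∧ (i ≡ᵇ z)) ≡ 0
  disjoint = count-false k λ i → ¬-not λ h → true≢false (subst (λ j → p j ≡ true) (≡ᵇ⇒≡ (∧-elimʳ {p i} h)) (∧-elimˡ h)) pz

≢⇒≡ᵇ-false : ∀ {k} {i a : Fin k} → i ≢ a → (i ≡ᵇ a) ≡ false
≢⇒≡ᵇ-false i≢a = ¬-not λ h → i≢a (≡ᵇ⇒≡ h)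

pair : ∀ {k} → Fin k → Fin k → Fin k → Bool
pair x y i = (i ≡ᵇ x) ∨ (i ≡ᵇ y)

triple : ∀ {k} → Fin k → Fin k → Fin k → Fin k → Bool
triple x y z i = pair x y i ∨ (i ≡ᵇ z)

count-pair : ∀ k {x y : Fin k} → y ≢ x → count k (pair x y) ≡ 2
count-pair k {x} {y} y≢x = trans (count-insert k (_≡ᵇ x) y (≢⇒≡ᵇ-false y≢x)) (cong suc (count-≡ᵇ k x))

count-triple : ∀ k {x y z : Fin k} → y ≢ x → z ≢ x → z ≢ y → count k (triple x y z) ≡ 3
count-triple k {x} {y} {z} y≢x z≢x z≢y =
  trans (count-insert k (pair x y) z (cong₂ _∨_ (≢⇒≡ᵇ-false z≢x) (≢⇒≡ᵇ-false z≢y))) (cong suc (count-pair k y≢x))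

pair-⊆ : ∀ {k} (A : Fin k → Bool) {x y} → A x ≡ true → A y ≡ true → pair x y ⊆V A
pair-⊆ A {x} {y} Ax Ay i h with ∨-elim {i ≡ᵇ x} h
... | inj₁ i≡x with refl ← ≡ᵇ⇒≡ i≡x = Ax
... | inj₂ i≡y with refl ← ≡ᵇ⇒≡ i≡y = Ay

triple-⊆ : ∀ {k} (A : Fin k → Bool) {x y z} → A x ≡ true → A y ≡ true → A z ≡ true → triple x y z ⊆V A
triple-⊆ A {x} {y} {z} Ax Ay Az i h with ∨-elim {pair x y i} h
... | inj₁ i∈xy = pair-⊆ A Ax Ay i i∈xy
... | inj₂ i≡z with refl ← ≡ᵇ⇒≡ i≡z = Az

pair-first : ∀ {k} (x y : Fin k) → pair x y x ≡ true
pair-first x y = ∨-introˡ (x ≡ᵇ y) (≡ᵇ-refl x)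

triple-first : ∀ {k} (x y z : Fin k) → triple x y z x ≡ true
triple-first x y z = ∨-introˡ (x ≡ᵇ z) (pair-first x y)

module _ {m n : ℕ} where

  K⟨⟩-isK23 : (P : Fin m → Bool) (Q : Fin n → Bool) → Is2×3 (count m P) (count n Q) → IsK23 K⟨ P , Q ⟩
  K⟨⟩-isK23 P Q sizes = P , Q , sizes , λ _ _ → refl

  new-edge : ∀ {X U : ESet m n} i j → X i j ≡ true → U i j ≡ false → ¬ (X ⊆E U)
  new-edge i j Xij Uij X⊆U = true≢false (X⊆U i j Xij) Uij

  -- Each member contains the edge (r , c) for a row r not used by the earlier members.
  column-sequence : (c : Fin n) → ∀ k (A : Fin m → Bool) (Q : Fin n → Bool) →
    count n Q ≡ 3 → Q c ≡ true → count m A ≡ suc (suc k) →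
    ∃ λ T → All IsK23 T × All (_⊆E K⟨ A , Q ⟩) T × length T ≡ suc k ×
            (∀ U → (∀ i → U i c ≡ false) → ProperFrom U T)
  column-sequence c zero A Q Q≡3 Qc A≡2 with choose-two m A 0 A≡2
  ... | r , _ , Ar , _ =
    K⟨ A , Q ⟩ ∷ [] , K⟨⟩-isK23 A Q (inj₁ (A≡2 , Q≡3)) ∷ [] , ⊆-refl ∷ [] , refl ,
    λ U U·c≡false → new-edge r c (∧-intro Ar Qc) (U·c≡false r) , tt
  column-sequence c (suc k) A Q Q≡3 Qc A≡ with choose m A (suc (suc k)) A≡
  ... | r , Ar , A′≡ with column-sequence c k (remove A r) Q Q≡3 Qc A′≡ | choose m (remove A r) (suc k) A′≡
  ...   | T , T-K23 , T⊆ , lenT , properT | r′ , A′r′ , _ =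
    T ++ X ∷ [] ,
    ++⁺ T-K23 (K⟨⟩-isK23 (pair r r′) Q (inj₁ (count-pair m (remove-≢ A r A′r′) , Q≡3)) ∷ []) ,
    ++⁺ (All.map (λ X⊆ → ⊆-trans X⊆ (K⟨⟩-mono (remove-⊆ A r) ⊆V-refl)) T⊆)
        (K⟨⟩-mono (pair-⊆ A Ar (remove-⊆ A r r′ A′r′)) ⊆V-refl ∷ []) ,
    trans (length-++ T) (trans (+-comm (length T) 1) (cong suc lenT)) ,
    λ U U·c≡false → ProperFrom-++ T (X ∷ []) (properT U U·c≡false)
      (new-edge r c (∧-intro (pair-first r r′) Qc)
        (cong₂ _∨_ (U·c≡false r) (¬-not λ h → true≢false (∧-elimˡ (⋃-⊆ T T⊆ r c h)) (remove-self A r))) , tt)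
    where
    X : ESet m n
    X = K⟨ pair r r′ , Q ⟩

  Bounded-sequence : (A : Fin m → Bool) (B : Fin n → Bool) → ℕ → ℕ → Set
  Bounded-sequence A B a b = ∃ λ S → All IsK23 S × All (_⊆E K⟨ A , B ⟩) S × ProperFrom ∅E S ×
    a * b ≤ length S + a + b

  two-column-sequence : ∀ k (A : Fin m → Bool) (B : Fin n → Bool) →
    count m A ≡ suc (suc k) → count n B ≡ 2 → Bounded-sequence A B (suc (suc k)) 2
  two-column-sequence zero A B A≡ B≡ = [] , [] , [] , tt , ≤-refl
  two-column-sequence (suc k) A B A≡ B≡ with choose m A (suc (suc k)) A≡
  ... | r , Ar , A′≡ with two-column-sequence k (remove A r) B A′≡ B≡ | choose-two m (remove A r) k A′≡ | choose n B 1 B≡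
  ...   | S , S-K23 , S⊆ , properS , size | r₁ , r₂ , A′r₁ , A′r₂ , r₂≢r₁ | c , Bc , _ =
    S ++ Y ∷ [] ,
    ++⁺ S-K23 (K⟨⟩-isK23 (triple r r₁ r₂) B
                (inj₂ (count-triple m (remove-≢ A r A′r₁) (remove-≢ A r A′r₂) r₂≢r₁ , B≡)) ∷ []) ,
    ++⁺ (All.map (λ X⊆ → ⊆-trans X⊆ (K⟨⟩-mono (remove-⊆ A r) ⊆V-refl)) S⊆)
        (K⟨⟩-mono (triple-⊆ A Ar (remove-⊆ A r r₁ A′r₁) (remove-⊆ A r r₂ A′r₂)) ⊆V-refl ∷ []) ,
    ProperFrom-++ S (Y ∷ []) properS
      (new-edge r c (∧-intro (triple-first r r₁ r₂) Bc)
        (¬-not λ h → true≢false (∧-elimˡ (⋃-⊆ S S⊆ r c h)) (remove-self A r)) , tt) ,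
    subst (λ s → suc (suc (suc k)) * 2 ≤ s + suc (suc (suc k)) + 2)
      (sym (trans (length-++ S) (+-comm (length S) 1))) (add-row k (length S) size)
    where
    Y : ESet m n
    Y = K⟨ triple r r₁ r₂ , B ⟩
    add-row : ∀ k s → suc (suc k) * 2 ≤ s + suc (suc k) + 2 → suc (suc (suc k)) * 2 ≤ suc s + suc (suc (suc k)) + 2
    add-row k s h = subst₂ _≤_ (lhs k) (rhs k s) (+-monoˡ-≤ 2 h)
      where
      lhs : ∀ k → suc (suc k) * 2 + 2 ≡ suc (suc (suc k)) * 2
      lhs = solve-∀
      rhs : ∀ k s → s + suc (suc k) + 2 + 2 ≡ suc s + suc (suc (suc k)) + 2
      rhs = solve-∀

  block-sequence : ∀ k l (A : Fin m → Bool) (B : Fin n → Bool) →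
    count m A ≡ suc (suc k) → count n B ≡ suc (suc l) → Bounded-sequence A B (suc (suc k)) (suc (suc l))
  block-sequence k zero    A B A≡ B≡ = two-column-sequence k A B A≡ B≡
  block-sequence k (suc l) A B A≡ B≡ with choose n B (suc (suc l)) B≡
  ... | c , Bc , B′≡ with block-sequence k l A (remove B c) A≡ B′≡ | choose-two n (remove B c) l B′≡
  ...   | S , S-K23 , S⊆ , properS , size | c₁ , c₂ , B′c₁ , B′c₂ , c₂≢c₁
    with column-sequence c k A (triple c c₁ c₂)
           (count-triple n (remove-≢ B c B′c₁) (remove-≢ B c B′c₂) c₂≢c₁) (triple-first c c₁ c₂) A≡
  ...     | T , T-K23 , T⊆ , lenT , properT =
    S ++ T ,
    ++⁺ S-K23 T-K23 ,
    ++⁺ (All.map (λ X⊆ → ⊆-trans X⊆ (K⟨⟩-mono ⊆V-refl (remove-⊆ B c))) S⊆)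
        (All.map (λ X⊆ → ⊆-trans X⊆ (K⟨⟩-mono ⊆V-refl
                    (triple-⊆ B Bc (remove-⊆ B c c₁ B′c₁) (remove-⊆ B c c₂ B′c₂)))) T⊆) ,
    ProperFrom-++ S T properS
      (properT (∅E ∪E ⋃E S) λ i → ¬-not λ h → true≢false (∧-elimʳ {A i} (⋃-⊆ S S⊆ i c h)) (remove-self B c)) ,
    subst (λ t → suc (suc k) * suc (suc (suc l)) ≤ t + suc (suc k) + suc (suc (suc l)))
      (sym (length-++ S)) (add-column k l (length S) (length T) lenT size)
    where
    add-column : ∀ k l s t → t ≡ suc k → suc (suc k) * suc (suc l) ≤ s + suc (suc k) + suc (suc l) →
      suc (suc k) * suc (suc (suc l)) ≤ (s + t) + suc (suc k) + suc (suc (suc l))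
    add-column k l s _ refl h = subst₂ _≤_ (lhs k l) (rhs k l s) (+-monoˡ-≤ (suc (suc k)) h)
      where
      lhs : ∀ k l → suc (suc k) * suc (suc l) + suc (suc k) ≡ suc (suc k) * suc (suc (suc l))
      lhs = solve-∀
      rhs : ∀ k l s → s + suc (suc k) + suc (suc l) + suc (suc k) ≡ (s + suc k) + suc (suc k) + suc (suc (suc l))
      rhs = solve-∀

  empty-sequence : ∀ {K : ESet m n} {a b} → a * b ≤ a + b →
    ∃ λ S → IsXSeq S × All (_⊆E K) S × a * b ≤ length S + a + b
  empty-sequence size = [] , ([] , tt) , [] , size

  K-sequence : (A : Fin m → Bool) (B : Fin n → Bool) →
    ∃ λ S → IsXSeq S × All (_⊆E K⟨ A , B ⟩) S × count m A * count n B ≤ length S + count m A + count n B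
  K-sequence A B with count m A in A≡ | count n B in B≡
  ... | 0 | _ = empty-sequence z≤n
  ... | 1 | b = empty-sequence (m≤n⇒m≤1+n (≤-reflexive (+-identityʳ b)))
  ... | suc (suc k) | 0 = empty-sequence (≤-trans (≤-reflexive (*-zeroʳ (suc (suc k)))) z≤n)
  ... | suc (suc k) | 1 = empty-sequence (≤-trans (≤-reflexive (*-identityʳ (suc (suc k)))) (m≤m+n _ 1))
  ... | suc (suc k) | suc (suc l) with block-sequence k l A B A≡ B≡
  ...   | S , S-K23 , S⊆ , properS , size = S , (S-K23 , proper S properS) , S⊆ , size
    where
    proper : ∀ S → ProperFrom ∅E S → ProperSeq S
    proper []      _       = tt
    proper (_ ∷ _) (_ , p) = p

-- Maximality and the rank function

module _ {m n : ℕ} where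

  K23-matroid-⪯ : (J : IndepPred {m} {n}) → K23Matroid J → J ⪯ Indep-f₁₀
  K23-matroid-⪯ J (MJ , K23-circuit-J) F JF I I⊆F _ with K-sequence (V₁ I) (V₂ I)
  ... | S , (S-K23 , properS) , S⊆K , size = +-cancelˡ-≤ (length S) _ _ (begin
    length S + ∣ I ∣E     ≡⟨ +-comm (length S) _ ⟩
    ∣ I ∣E + length S     ≤⟨ circuit-sequence-bound MJ S (All.map (K23-circuit-J _) S-K23) properS ⊆-refl
                               (IsMatroid.indep-down MJ I⊆F JF) ⟩
    ∣ I ∪E ⋃E S ∣E        ≤⟨ ∣∣-mono (∪-lub (⊆K[] I) (⋃-⊆ S S⊆K)) ⟩
    ∣ K[ I ] ∣E           ≡⟨ ∣K∣ (V₁ I) (V₂ I) ⟩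
    count m (V₁ I) * count n (V₂ I)      ≤⟨ size ⟩
    length S + count m (V₁ I) + count n (V₂ I) ≡⟨ +-assoc (length S) _ _ ⟩
    length S + f₁₀ I      ∎)
    where open ≤-Reasoning

  f₁₀-K23-matroid : K23Matroid (Indep-f₁₀ {m} {n})
  f₁₀-K23-matroid = f₁₀-matroid , K23-circuit

  f₁₀-val-bound : ∀ {F I : ESet m n} S → IsXSeq S → I ⊆E F → Indep-f₁₀ I → ∣ I ∣E ≤ val F S
  f₁₀-val-bound S (S-K23 , properS) = val-bound f₁₀-matroid S (All.map (K23-circuit _) S-K23) properS

  valK23 : ESet m n → ℕ
  valK23 F = ∣ CertifiedBasis.basis (certifiedBasis F) ∣E

  -- The sequence filling the complete bipartite graph on the vertices of the tight core.
  optimal-sequence : (F : ESet m n) → ∃ λ S → IsXSeq S × val F S ≡ valK23 F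
  optimal-sequence F with K-sequence (V₁ core) (V₂ core)
    where open CertifiedBasis (certifiedBasis F)
  ... | S , (S-K23 , properS) , S⊆K , size =
    S , (S-K23 , properS) , trans (cong (_∸ length S) (≤-antisym upper lower)) (m+n∸n≡m _ (length S))
    where
    open CertifiedBasis (certifiedBasis F)
    open ≤-Reasoning
    a b : ℕ
    a = count m (V₁ core)
    b = count n (V₂ core)
    lower : ∣ basis ∣E + length S ≤ ∣ F ∪E ⋃E S ∣E
    lower = circuit-sequence-bound f₁₀-matroid S (All.map (K23-circuit _) S-K23) properS basis-⊆ basis-indep
    upper : ∣ F ∪E ⋃E S ∣E ≤ ∣ basis ∣E + length S
    upper = +-cancelʳ-≤ (a + b) _ _ (begin
      ∣ F ∪E ⋃E S ∣E + (a + b)                          ≤⟨ +-mono-≤ (∣∣-mono (∪-lub covers (⊆-trans (⋃-⊆ S S⊆K) (∪-⊆ʳ {F = basis}))))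
                                                                     (≤-trans core-tight (∣∣-mono core⊆B∩K)) ⟩
      ∣ basis ∪E K[ core ] ∣E + ∣ basis ∩E K[ core ] ∣E ≡⟨ ∣∪∣+∣∩∣ basis K[ core ] ⟩
      ∣ basis ∣E + ∣ K[ core ] ∣E                       ≡⟨ cong (∣ basis ∣E +_) (∣K∣ (V₁ core) (V₂ core)) ⟩
      ∣ basis ∣E + a * b                                ≤⟨ +-monoʳ-≤ ∣ basis ∣E size ⟩
      ∣ basis ∣E + (length S + a + b)                   ≡⟨ cong (∣ basis ∣E +_) (+-assoc (length S) a b) ⟩
      ∣ basis ∣E + (length S + (a + b))                 ≡⟨ sym (+-assoc ∣ basis ∣E (length S) (a + b)) ⟩
      ∣ basis ∣E + length S + (a + b)                   ∎)
      where
      core⊆B∩K : core ⊆E (basis ∩E K[ core ])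
      core⊆B∩K i j h = ∧-intro (core-⊆ i j h) (⊆K[] core i j h)

  valK23-is-val : ∀ F → IsValK23 F (valK23 F)
  valK23-is-val F = optimal-sequence F , λ S xseq →
    f₁₀-val-bound S xseq (CertifiedBasis.basis-⊆ (certifiedBasis F)) (CertifiedBasis.basis-indep (certifiedBasis F))

  valK23-is-rank : IsRankFunction (Indep-f₁₀ {m} {n}) valK23
  valK23-is-rank F = (basis , basis-⊆ , basis-indep , refl) , λ I I⊆F II →
    let (S , xseq , val≡) = optimal-sequence F in subst (∣ I ∣E ≤_) val≡ (f₁₀-val-bound S xseq I⊆F II)
    where open CertifiedBasis (certifiedBasis F)

theorem4p4 : (m n : ℕ) → 2 ≤ m → 2 ≤ n → 3 ≤ m ⊔ n →
    IsMatroid (Indep-f₁₀ {m} {n}) ×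
    IsMaximalK23 (Indep-f₁₀ {m} {n}) ×
    (∀ J → IsMaximalK23 {m} {n} J → (J ⪯ Indep-f₁₀) × (Indep-f₁₀ ⪯ J)) ×
    (∃ λ (valK23 : ESet m n → ℕ) → (∀ F → IsValK23 F (valK23 F)) × IsRankFunction Indep-f₁₀ valK23)
theorem4p4 m n _ _ _ =
  f₁₀-matroid ,
  (f₁₀-K23-matroid , λ J J-K23 _ → K23-matroid-⪯ J J-K23) ,
  (λ J (J-K23 , J-maximal) → K23-matroid-⪯ J J-K23 , J-maximal Indep-f₁₀ f₁₀-K23-matroid (K23-matroid-⪯ J J-K23)) ,
  valK23 , valK23-is-val , valK23-is-rank
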